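{- Let $\phi$ be the rank $r\ge1$ Drinfeld module with $\phi_t=\theta+A_1\tau+\cdots+A_r\tau^r$, $A_r\neq0$, and let $\mathcal{B}_n(t)$ ($n\in\mathbb{Z}$) be as defined below. Then for all $m\ge1$: (a) $\displaystyle\mathcal{B}_m(t)=\sum_{k=1}^r\frac{A_k}{t-\theta^{q^k}}\cdot\mathcal{B}_{m-k}(t)^{(k)}$; (b) $\displaystyle\mathcal{B}_m(t)=\sum_{k=1}^r\frac{A_k^{q^{m-k}}}{t-\theta^{q^m}}\cdot\mathcal{B}_{m-k}(t)$, where terms with $m-k<0$ are zero since $\mathcal{B}_{m-k}=0$ then.
   Context: $\mathbb{C}_\infty$ is the completion of an algebraic closure of $\mathbb{F}_q((1/\theta))$. $\tau$ is the $q$-th power Frobenius with $\tau c=c^q\tau$; the Drinfeld module is the $\mathbb{F}_q$-algebra homomorphism $\phi:\mathbb{F}_q[t]\to\mathbb{C}_\infty[\tau]$ determined by $\phi_t$. For a rational function (or Laurent series) $f=\sum c_it^i$ with coefficients in $\mathbb{C}_\infty$, the $k$-th Frobenius twist is $f^{(k)}=\sum c_i^{q^k}t^i$ (for a rational function, this raises all coefficients in $\mathbb{C}_\infty$ to the $q^k$-th power, fixing $t$). Shadowed partitions: for $n\ge1$, $P_r(n)$ is the set of $r$-tuples $(S_1,\dots,S_r)$ of subsets of $\{0,\dots,n-1\}$ such that the sets $S_i+j=\{x+j:x\in S_i\}$ ($1\le i\le r$, $0\le j\le i-1$) form a partition of $\{0,\dots,n-1\}$; $P_r(0)=\{(\emptyset,\dots,\emptyset)\}$;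 $P_r(-n)=\emptyset$ for $n>0$. For $n\in\mathbb{Z}$, $\mathcal{B}_n(t)=\sum_{\mathbf{S}\in P_r(n)}\prod_{i=1}^r\prod_{j\in S_i}\frac{A_i^{q^j}}{t-\theta^{q^{i+j}}}\in\mathbb{C}_\infty(t)$; thus $\mathcal{B}_0=1$ and $\mathcal{B}_{ -n}=0$ for $n>0$. -}

module Defs where

open import Level using (Level; _⊔_) renaming (suc to lsuc)
open import Algebra.Bundles using (CommutativeRing)
open import Data.Bool using (Bool; true; false; not; _∧_; _∨_)
open import Data.Nat as ℕ using (ℕ; zero; suc; _∸_; _≤ᵇ_; _<ᵇ_; _≡ᵇ_)
open import Data.Fin using (Fin; toℕ)
open import Data.Integer as ℤ using (ℤ; +_; -[1+_])
open import Data.List using (List; []; _∷_; [_]; map; foldr; concatMap; filterᵇ; upTo; allFin)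
open import Data.Nat.ListAction using (sum)
open import Data.Vec using (Vec; []; _∷_; lookup)
open import Relation.Nullary using (¬_)

-- Fields (the stdlib has no Field bundle).  The inverse is a total
-- function; only its value on nonzero elements is constrained.

record Field (c ℓ : Level) : Set (lsuc (c ⊔ ℓ)) where
  field
    commutativeRing : CommutativeRing c ℓ
  open CommutativeRing commutativeRing public
  field
    _⁻¹        : Carrier → Carrier
    0≉1        : ¬ (0# ≈ 1#)
    ⁻¹-inverse : ∀ x → ¬ (x ≈ 0#) → (x * (x ⁻¹)) ≈ 1#

module _ {c ℓ : Level} (K : Field c ℓ) where
  open Field K

  pow : Carrier → ℕ → Carrier
  pow x zero    = 1#
  pow x (suc n) = x * pow x n

  natK : ℕ → Carrier
  natK zero    = 0#
  natK (suc n) = 1# + natK n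

  HasChar : ℕ → Set ℓ
  HasChar p = natK p ≈ 0#

-- Rational functions in the variable t with coefficients in a set C,
-- given by (formal) expressions.

data RatExpr {c} (C : Set c) : Set c where
  const : C → RatExpr C
  var   : RatExpr C
  _⊕_   : RatExpr C → RatExpr C → RatExpr C
  _⊗_   : RatExpr C → RatExpr C → RatExpr C
  neg   : RatExpr C → RatExpr C
  inv   : RatExpr C → RatExpr C

infixl 6 _⊕_
infixl 7 _⊗_

module _ {c ℓ : Level} (K : Field c ℓ) where
  open Field K

  eval : Carrier → RatExpr Carrier → Carrier
  eval x (const a) = a
  eval x var       = x
  eval x (e ⊕ f)   = eval x e + eval x f
  eval x (e ⊗ f)   = eval x e * eval x f
  eval x (neg e)   = - eval x e
  eval x (inv e)   = (eval x e) ⁻¹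

  twist : (q k : ℕ) → RatExpr Carrier → RatExpr Carrier
  twist q k (const a) = const (pow K a (q ℕ.^ k))
  twist q k var       = var
  twist q k (e ⊕ f)   = twist q k e ⊕ twist q k f
  twist q k (e ⊗ f)   = twist q k e ⊗ twist q k f
  twist q k (neg e)   = neg (twist q k e)
  twist q k (inv e)   = inv (twist q k e)

  Σᵉ : List (RatExpr Carrier) → RatExpr Carrier
  Σᵉ = foldr _⊕_ (const 0#)

  Πᵉ : List (RatExpr Carrier) → RatExpr Carrier
  Πᵉ = foldr _⊗_ (const 1#)

-- A subset of {0,…,n-1} is its characteristic
-- vector Vec Bool n; an r-tuple (S_1,…,S_r) is a Vec (Vec Bool n) r whose
-- entry at position i' : Fin r is S_i with i = toℕ i' + 1.

mem : ∀ {n} → Vec Bool n → ℕ → Bool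
mem []      _       = false
mem (b ∷ v) zero    = b
mem (b ∷ v) (suc x) = mem v x

allSubsets : (n : ℕ) → List (Vec Bool n)
allSubsets zero    = [ [] ]
allSubsets (suc n) = concatMap (λ v → (false ∷ v) ∷ (true ∷ v) ∷ []) (allSubsets n)

allTuples : ∀ {a} {A : Set a} (r : ℕ) → List A → List (Vec A r)
allTuples zero    xs = [ [] ]
allTuples (suc r) xs = concatMap (λ x → map (x ∷_) (allTuples r xs)) xs

all : ∀ {a} {A : Set a} → (A → Bool) → List A → Bool
all p = foldr (λ x b → p x ∧ b) true

fromTo : ℕ → ℕ → List ℕ
fromTo a b = map (a ℕ.+_) (upTo (suc b ∸ a))

module _ {n r : ℕ} (S : Vec (Vec Bool n) r) where
  -- x ∈ S_i + j  (with i = toℕ i' + 1)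
  inShift : Fin r → ℕ → ℕ → Bool
  inShift i' j x = (j ≤ᵇ x) ∧ mem (lookup S i') (x ∸ j)

  coverCount : ℕ → ℕ
  coverCount x = sum (map (λ i' → sum (map (λ j → if′ (inShift i' j x)) (upTo (suc (toℕ i'))))) (allFin r))
    where
    if′ : Bool → ℕ
    if′ true  = 1
    if′ false = 0

  -- the sets S_i + j (1 ≤ i ≤ r, 0 ≤ j ≤ i-1) form a partition of
  -- {0,…,n-1}: each is contained in {0,…,n-1} (i.e. s + (i-1) < n for
  -- s ∈ S_i), and every x < n lies in exactly one of them.
  isShadowed : Bool
  isShadowed =
    all (λ i' → all (λ s → not (mem (lookup S i') s) ∨ (s ℕ.+ toℕ i' <ᵇ n)) (upTo n)) (allFin r)
    ∧ all (λ x → coverCount x ≡ᵇ 1) (upTo n)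

P : (r n : ℕ) → List (Vec (Vec Bool n) r)
P r n = filterᵇ isShadowed (allTuples r (allSubsets n))

module _ {c ℓ : Level} (K : Field c ℓ) where
  open Field K

  -- parameters: q, θ, r and the coefficients A : ℕ → K (A k = A_k, 1 ≤ k ≤ r)
  𝓑ℕ : (q : ℕ) (θ : Carrier) (r : ℕ) (A : ℕ → Carrier) (n : ℕ) → RatExpr Carrier
  𝓑ℕ q θ r A n = Σᵉ K (map term (P r n))
    where
    factor : ℕ → ℕ → RatExpr Carrier
    factor i j = const (pow K (A i) (q ℕ.^ j)) ⊗ inv (var ⊕ neg (const (pow K θ (q ℕ.^ (i ℕ.+ j)))))
    term : Vec (Vec Bool n) r → RatExpr Carrier
    term S = Πᵉ K (map (λ i' → Πᵉ K (map (factor (suc (toℕ i'))) (filterᵇ (mem (lookup S i')) (upTo n)))) (allFin r))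

  𝓑 : (q : ℕ) (θ : Carrier) (r : ℕ) (A : ℕ → Carrier) → ℤ → RatExpr Carrier
  𝓑 q θ r A (+ n)     = 𝓑ℕ q θ r A n
  𝓑 q θ r A -[1+ n ]  = const 0#

module Submission where

-- An r-tuple of subsets of {0,…,n−1} is read as an r × n Boolean matrix, scanned column by
-- column.  In a shadowed partition position 0 lies in exactly one block S_k + j, which forces
-- j = 0: the first column is the k-th unit vector, the next k − 1 columns are empty, and the
-- remaining columns form a shadowed partition of n − k shifted by k.  Shifting the index j of
-- the factor A_i^{q^j}/(t − θ^{q^{i+j}}) by k is the k-th Frobenius twist, which gives (a).
-- Removing from a partition first its first block and then its last block, or the other way
-- round, yields the same double sum; with (a), strong induction on m (for all weights at
-- once) then gives (b).

open import Defs
open import Level using (Level)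
open import Data.Nat using (ℕ; _^_; _≤_)
open import Data.Nat.Primality using (Prime)
open import Data.Integer using (+_; _-_)
open import Data.List using (map)
open import Data.Product using (_×_)
open import Relation.Nullary using (¬_)

open import Algebra.Bundles using (CommutativeMonoid; CommutativeSemiring)
import Algebra.Properties.CommutativeSemigroup as CommutativeSemigroupProperties
open import Data.Bool using (Bool; true; false; not; _∧_; _∨_; if_then_else_; T)
import Data.Bool.Properties as Boolₚ
import Data.Nat as Nat
open Nat using (zero; suc; _∸_; _≤ᵇ_; _<ᵇ_; _≡ᵇ_; _<_; z≤n; s≤s)
import Data.Nat.Properties as ℕₚ
open import Data.Nat.Primality using (prime⇒nonZero)
open import Data.Nat.Induction using (<-rec)
open import Data.Nat.ListAction using (sum)
open import Data.Bool.ListAction using (and)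
open import Data.Fin using (Fin; toℕ)
import Data.Fin as Fin
open import Data.Vec using (Vec; []; _∷_; lookup; zipWith; head; tail; replicate)
import Data.Vec as Vec
open import Data.List using (List; []; _∷_; tabulate; foldr; concatMap; filterᵇ; upTo; allFin; _++_; [_])
import Data.List.Properties as Listₚ
open import Data.Product using (∃; _,_)
open import Function using (_∘_; id)
open import Relation.Nullary using (yes; no)
open import Relation.Nullary.Decidable using (dec-true; dec-false)
import Data.Integer as ℤ
import Data.Integer.Properties as ℤₚ
import Relation.Binary.PropositionalEquality as ≡
open ≡ using (_≡_; module ≡-Reasoning)

private
  variable
    a b : Level
    A B : Set a
    n r : ℕ

imap : (ℕ → A → B) → Vec A r → List B
imap f []       = []
imap f (x ∷ xs) = f 0 x ∷ imap (f ∘ suc) xs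

map-allFin-lookup : (f : ℕ → A → B) (xs : Vec A r) →
  map (λ i → f (toℕ i) (lookup xs i)) (allFin r) ≡ imap f xs
map-allFin-lookup f []                 = ≡.refl
map-allFin-lookup {r = suc r} f (x ∷ xs) = ≡.cong (f 0 x ∷_) (begin
  map (λ i → f (toℕ i) (lookup (x ∷ xs) i)) (tabulate Fin.suc)
    ≡⟨ Listₚ.map-tabulate Fin.suc _ ⟩
  tabulate (λ i → f (suc (toℕ i)) (lookup xs i))
    ≡⟨ Listₚ.map-tabulate id _ ⟨
  map (λ i → f (suc (toℕ i)) (lookup xs i)) (allFin r)
    ≡⟨ map-allFin-lookup (f ∘ suc) xs ⟩
  imap (f ∘ suc) xs ∎)
  where open ≡-Reasoning

map-upTo-suc : (f : ℕ → A) (n : ℕ) → map f (upTo (suc n)) ≡ f 0 ∷ map (f ∘ suc) (upTo n)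
map-upTo-suc f n = ≡.cong (f 0 ∷_) (≡.trans (Listₚ.map-applyUpTo suc f n) (≡.sym (Listₚ.map-upTo (f ∘ suc) n)))

all-cong : {p q : A → Bool} → (∀ x → p x ≡ q x) → ∀ xs → all p xs ≡ all q xs
all-cong p≡q []       = ≡.refl
all-cong p≡q (x ∷ xs) = ≡.cong₂ _∧_ (p≡q x) (all-cong p≡q xs)

all≡and∘map : (p : A → Bool) → ∀ xs → all p xs ≡ and (map p xs)
all≡and∘map p []       = ≡.refl
all≡and∘map p (x ∷ xs) = ≡.cong (p x ∧_) (all≡and∘map p xs)

all-upTo-suc : (p : ℕ → Bool) (n : ℕ) → all p (upTo (suc n)) ≡ p 0 ∧ all (p ∘ suc) (upTo n)
all-upTo-suc p n = begin
  all p (upTo (suc n))              ≡⟨ all≡and∘map p (upTo (suc n)) ⟩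
  and (map p (upTo (suc n)))        ≡⟨ ≡.cong and (map-upTo-suc p n) ⟩
  p 0 ∧ and (map (p ∘ suc) (upTo n)) ≡⟨ ≡.cong (p 0 ∧_) (all≡and∘map (p ∘ suc) (upTo n)) ⟨
  p 0 ∧ all (p ∘ suc) (upTo n)      ∎
  where open ≡-Reasoning

<ᵇ-suc : ∀ k n → (k <ᵇ suc n) ≡ (k ≤ᵇ n)
<ᵇ-suc zero    n = ≡.refl
<ᵇ-suc (suc k) n = ≡.refl

≤ᵇ-∧-∸ : ∀ n k l → ((k ≤ᵇ n) ∧ (l ≤ᵇ n ∸ k)) ≡ (k Nat.+ l ≤ᵇ n)
≤ᵇ-∧-∸ n       zero    l = ≡.refl
≤ᵇ-∧-∸ zero    (suc k) l = ≡.refl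
≤ᵇ-∧-∸ (suc n) (suc k) l =
  ≡.trans (≡.cong (_∧ (l ≤ᵇ n ∸ k)) (<ᵇ-suc k n))
          (≡.trans (≤ᵇ-∧-∸ n k l) (≡.sym (<ᵇ-suc (k Nat.+ l) n)))

∸-∸-comm : ∀ n k l → n ∸ k ∸ l ≡ n ∸ l ∸ k
∸-∸-comm n k l = ≡.trans (ℕₚ.∸-+-assoc n k l)
                         (≡.trans (≡.cong (n ∸_) (ℕₚ.+-comm k l)) (≡.sym (ℕₚ.∸-+-assoc n l k)))

+-∸-∸ : ∀ {n k l} → k Nat.+ l ≤ n → k Nat.+ (n ∸ k ∸ l) ≡ n ∸ l
+-∸-∸ {n} {k} {l} k+l≤n = ≡.trans (≡.cong (k Nat.+_) (∸-∸-comm n k l)) (ℕₚ.m+[n∸m]≡n k≤n∸l)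
  where
  k≤n∸l : k Nat.≤ n ∸ l
  k≤n∸l = ≡.subst (Nat._≤ n ∸ l) (ℕₚ.m+n∸n≡m k l) (ℕₚ.∸-monoˡ-≤ l k+l≤n)

head-zipWith-∷ : (c : Vec A r) (S : Vec (Vec A n) r) → Vec.map head (zipWith _∷_ c S) ≡ c
head-zipWith-∷ []      []      = ≡.refl
head-zipWith-∷ (b ∷ c) (v ∷ S) = ≡.cong (b ∷_) (head-zipWith-∷ c S)

tail-zipWith-∷ : (c : Vec A r) (S : Vec (Vec A n) r) → Vec.map tail (zipWith _∷_ c S) ≡ S
tail-zipWith-∷ []      []      = ≡.refl
tail-zipWith-∷ (b ∷ c) (v ∷ S) = ≡.cong (v ∷_) (tail-zipWith-∷ c S)

zipWith-∷-head-tail : (S : Vec (Vec A (suc n)) r) → zipWith _∷_ (Vec.map head S) (Vec.map tail S) ≡ S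
zipWith-∷-head-tail []             = ≡.refl
zipWith-∷-head-tail ((b ∷ v) ∷ S) = ≡.cong ((b ∷ v) ∷_) (zipWith-∷-head-tail S)

noneSet : Vec Bool r → Bool
noneSet []      = true
noneSet (b ∷ c) = not b ∧ noneSet c

isUnit : Vec Bool r → Bool
isUnit []          = false
isUnit (true ∷ c)  = noneSet c
isUnit (false ∷ c) = isUnit c

unit : (r k : ℕ) → Vec Bool r
unit zero    k       = []
unit (suc r) zero    = true ∷ replicate r false
unit (suc r) (suc k) = false ∷ unit r k

unitAnd : Vec Bool r → (ℕ → Bool) → Bool
unitAnd []          h = false
unitAnd (true ∷ c)  h = noneSet c ∧ h 0
unitAnd (false ∷ c) h = unitAnd c (h ∘ suc)

noneSet-replicate : ∀ r → noneSet (replicate r false) ≡ true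
noneSet-replicate zero    = ≡.refl
noneSet-replicate (suc r) = noneSet-replicate r

noneSet⇒replicate : (c : Vec Bool r) → noneSet c ≡ true → c ≡ replicate r false
noneSet⇒replicate []          _  = ≡.refl
noneSet⇒replicate (false ∷ c) eq = ≡.cong (false ∷_) (noneSet⇒replicate c eq)

isUnit⇒unit : (c : Vec Bool r) → isUnit c ≡ true → ∃ λ k → k < r × c ≡ unit r k
isUnit⇒unit (true ∷ c)  eq = 0 , s≤s z≤n , ≡.cong (true ∷_) (noneSet⇒replicate c eq)
isUnit⇒unit (false ∷ c) eq with isUnit⇒unit c eq
... | k , k<r , c≡unit = suc k , s≤s k<r , ≡.cong (false ∷_) c≡unit

unitAnd-unit : ∀ {k} → k < r → (h : ℕ → Bool) → unitAnd (unit r k) h ≡ h k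
unitAnd-unit {suc r} {zero}  _         h = ≡.cong (_∧ h 0) (noneSet-replicate r)
unitAnd-unit {suc r} {suc k} (s≤s k<r) h = unitAnd-unit k<r (h ∘ suc)

unitAnd-cong : (c : Vec Bool r) {h h′ : ℕ → Bool} → (∀ k → h k ≡ h′ k) → unitAnd c h ≡ unitAnd c h′
unitAnd-cong []          h≡h′ = ≡.refl
unitAnd-cong (true ∷ c)  h≡h′ = ≡.cong (noneSet c ∧_) (h≡h′ 0)
unitAnd-cong (false ∷ c) h≡h′ = unitAnd-cong c (h≡h′ ∘ suc)

unitAnd-nonUnit : (c : Vec Bool r) → isUnit c ≡ false → (h : ℕ → Bool) → unitAnd c h ≡ false
unitAnd-nonUnit []          _  h = ≡.refl
unitAnd-nonUnit (true ∷ c)  eq h = ≡.cong (_∧ h 0) eq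
unitAnd-nonUnit (false ∷ c) eq h = unitAnd-nonUnit c eq (h ∘ suc)

bools : List Bool
bools = false ∷ true ∷ []

module FoldProperties {c ℓ} (M : CommutativeMonoid c ℓ) where
  open CommutativeMonoid M
  open import Relation.Binary.Reasoning.Setoid setoid
  open CommutativeSemigroupProperties commutativeSemigroup using (interchange)

  fold : List Carrier → Carrier
  fold = foldr _∙_ ε

  fold-cong : {f g : A → Carrier} → (∀ x → f x ≈ g x) → ∀ xs → fold (map f xs) ≈ fold (map g xs)
  fold-cong f≈g []       = refl
  fold-cong f≈g (x ∷ xs) = ∙-cong (f≈g x) (fold-cong f≈g xs)

  fold-ε : {f : A → Carrier} → (∀ x → f x ≈ ε) → ∀ xs → fold (map f xs) ≈ ε
  fold-ε f≈ε []       = refl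
  fold-ε f≈ε (x ∷ xs) = trans (∙-cong (f≈ε x) (fold-ε f≈ε xs)) (identityˡ ε)

  fold-∙ : (f g : A → Carrier) → ∀ xs →
    fold (map (λ x → f x ∙ g x) xs) ≈ fold (map f xs) ∙ fold (map g xs)
  fold-∙ f g []       = sym (identityˡ ε)
  fold-∙ f g (x ∷ xs) = trans (∙-cong refl (fold-∙ f g xs)) (interchange (f x) (g x) _ _)

  fold-++ : ∀ xs ys → fold (xs ++ ys) ≈ fold xs ∙ fold ys
  fold-++ []       ys = sym (identityˡ _)
  fold-++ (x ∷ xs) ys = trans (∙-cong refl (fold-++ xs ys)) (sym (assoc x _ _))

  fold-concatMap : (f : B → Carrier) (g : A → List B) → ∀ xs →
    fold (map f (concatMap g xs)) ≈ fold (map (λ x → fold (map f (g x))) xs)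
  fold-concatMap f g []       = refl
  fold-concatMap f g (x ∷ xs) = begin
    fold (map f (g x ++ concatMap g xs))         ≡⟨ ≡.cong fold (Listₚ.map-++ f (g x) _) ⟩
    fold (map f (g x) ++ map f (concatMap g xs)) ≈⟨ fold-++ (map f (g x)) _ ⟩
    fold (map f (g x)) ∙ fold (map f (concatMap g xs))
      ≈⟨ ∙-cong refl (fold-concatMap f g xs) ⟩
    fold (map (λ x → fold (map f (g x))) (x ∷ xs)) ∎

  fold-comm : (F : A → B → Carrier) → ∀ xs ys →
    fold (map (λ x → fold (map (F x) ys)) xs) ≈ fold (map (λ y → fold (map (λ x → F x y) xs)) ys)
  fold-comm F []       ys = sym (fold-ε (λ _ → refl) ys)
  fold-comm F (x ∷ xs) ys = trans (∙-cong refl (fold-comm F xs ys)) (sym (fold-∙ (F x) _ ys))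

  fold-cong-upTo : ∀ n {f g : ℕ → Carrier} → (∀ k → k < n → f k ≈ g k) →
    fold (map f (upTo n)) ≈ fold (map g (upTo n))
  fold-cong-upTo zero    f≈g = refl
  fold-cong-upTo (suc n) {f} {g} f≈g = begin
    fold (map f (upTo (suc n)))          ≡⟨ ≡.cong fold (map-upTo-suc f n) ⟩
    f 0 ∙ fold (map (f ∘ suc) (upTo n))
      ≈⟨ ∙-cong (f≈g 0 (s≤s z≤n)) (fold-cong-upTo n (λ k k<n → f≈g (suc k) (s≤s k<n))) ⟩
    g 0 ∙ fold (map (g ∘ suc) (upTo n))  ≡⟨ ≡.cong fold (map-upTo-suc g n) ⟨
    fold (map g (upTo (suc n)))          ∎

  fold-if : ∀ b (f : A → Carrier) xs →
    fold (map (λ x → if b then f x else ε) xs) ≈ (if b then fold (map f xs) else ε)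
  fold-if true  f xs = refl
  fold-if false f xs = fold-ε (λ _ → refl) xs

  fold-filterᵇ : (p : A → Bool) (f : A → Carrier) → ∀ xs →
    fold (map f (filterᵇ p xs)) ≈ fold (map (λ x → if p x then f x else ε) xs)
  fold-filterᵇ p f []       = refl
  fold-filterᵇ p f (x ∷ xs) with p x
  ... | true  = ∙-cong refl (fold-filterᵇ p f xs)
  ... | false = trans (fold-filterᵇ p f xs) (sym (identityˡ _))

  fold-imap-zipWith-∷ : {G : ℕ → Vec A (suc n) → Carrier} {H : ℕ → A → Carrier}
                        {G′ : ℕ → Vec A n → Carrier} →
    (∀ k x v → G k (x ∷ v) ≈ H k x ∙ G′ k v) → (c : Vec A r) (S : Vec (Vec A n) r) →
    fold (imap G (zipWith _∷_ c S)) ≈ fold (imap H c) ∙ fold (imap G′ S)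
  fold-imap-zipWith-∷ split []      []      = sym (identityˡ ε)
  fold-imap-zipWith-∷ split (x ∷ c) (v ∷ S) =
    trans (∙-cong (split 0 x v) (fold-imap-zipWith-∷ (split ∘ suc) c S)) (interchange _ _ _ _)

  fold-imap-none : {G : ℕ → Bool → Carrier} → (∀ k → G k false ≈ ε) →
    (c : Vec Bool r) → noneSet c ≡ true → fold (imap G c) ≈ ε
  fold-imap-none G-false≈ε []          _  = refl
  fold-imap-none G-false≈ε (false ∷ c) eq =
    trans (∙-cong (G-false≈ε 0) (fold-imap-none (G-false≈ε ∘ suc) c eq)) (identityˡ ε)

  fold-imap-unit : {G : ℕ → Bool → Carrier} → (∀ k → G k false ≈ ε) →
    ∀ {k} → k < r → fold (imap G (unit r k)) ≈ G k true
  fold-imap-unit {suc r} G-false≈ε {zero}  _         =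
    trans (∙-cong refl (fold-imap-none (G-false≈ε ∘ suc) (replicate r false) (noneSet-replicate r))) (identityʳ _)
  fold-imap-unit {suc r} G-false≈ε {suc k} (s≤s k<r) =
    trans (∙-cong (G-false≈ε 0) (fold-imap-unit (G-false≈ε ∘ suc) k<r)) (identityˡ _)

  fold-allTuples-suc : (X : List A) (F : Vec A (suc r) → Carrier) →
    fold (map F (allTuples (suc r) X)) ≈ fold (map (λ x → fold (map (F ∘ (x ∷_)) (allTuples r X))) X)
  fold-allTuples-suc {r = r} X F =
    trans (fold-concatMap F _ X)
          (fold-cong (λ x → reflexive (≡.cong fold (≡.sym (Listₚ.map-∘ (allTuples r X))))) X)

  fold-allTuples-singleton : ∀ r (x : A) (F : Vec A r → Carrier) →
    fold (map F (allTuples r [ x ])) ≈ F (replicate r x)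
  fold-allTuples-singleton zero    x F = identityʳ _
  fold-allTuples-singleton (suc r) x F =
    trans (fold-allTuples-suc [ x ] F) (trans (identityʳ _) (fold-allTuples-singleton r x (F ∘ (x ∷_))))

  fold-columns : ∀ r (F : Vec (Vec Bool (suc n)) r → Carrier) →
    fold (map F (allTuples r (allSubsets (suc n)))) ≈
    fold (map (λ c → fold (map (F ∘ zipWith _∷_ c) (allTuples r (allSubsets n)))) (allTuples r bools))
  fold-columns zero    F = sym (identityʳ _)
  fold-columns {n} (suc r) F = begin
    fold (map F (allTuples (suc r) Sₙ₊₁))
      ≈⟨ fold-allTuples-suc Sₙ₊₁ F ⟩
    fold (map (λ x → fold (map (F ∘ (x ∷_)) (allTuples r Sₙ₊₁))) Sₙ₊₁)
      ≈⟨ fold-cong (λ x → fold-columns r (F ∘ (x ∷_))) Sₙ₊₁ ⟩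
    fold (map H Sₙ₊₁)
      ≈⟨ fold-concatMap H _ Sₙ ⟩
    fold (map (λ v → fold (map (λ b → H (b ∷ v)) bools)) Sₙ)
      ≈⟨ fold-comm (λ v b → H (b ∷ v)) Sₙ bools ⟩
    fold (map (λ b → fold (map (λ v → H (b ∷ v)) Sₙ)) bools)
      ≈⟨ fold-cong (λ b → fold-comm (λ v c → fold (map (F ∘ zipWith _∷_ (b ∷ c) ∘ (v ∷_)) Tₙ)) Sₙ Cᵣ) bools ⟩
    fold (map (λ b → fold (map (λ c → fold (map (λ v → fold (map (F ∘ zipWith _∷_ (b ∷ c) ∘ (v ∷_)) Tₙ)) Sₙ)) Cᵣ)) bools)
      ≈⟨ fold-cong (λ b → fold-cong (λ c → fold-allTuples-suc Sₙ (F ∘ zipWith _∷_ (b ∷ c))) Cᵣ) bools ⟨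
    fold (map (λ b → fold (map (λ c → fold (map (F ∘ zipWith _∷_ (b ∷ c)) (allTuples (suc r) Sₙ))) Cᵣ)) bools)
      ≈⟨ fold-allTuples-suc bools (λ c → fold (map (F ∘ zipWith _∷_ c) (allTuples (suc r) Sₙ))) ⟨
    fold (map (λ c → fold (map (F ∘ zipWith _∷_ c) (allTuples (suc r) Sₙ))) (allTuples (suc r) bools)) ∎
    where
    Sₙ : List (Vec Bool n)
    Sₙ = allSubsets n
    Sₙ₊₁ : List (Vec Bool (suc n))
    Sₙ₊₁ = allSubsets (suc n)
    Tₙ : List (Vec (Vec Bool n) r)
    Tₙ = allTuples r Sₙ
    Cᵣ : List (Vec Bool r)
    Cᵣ = allTuples r bools
    H : Vec Bool (suc n) → Carrier
    H x = fold (map (λ c → fold (map (F ∘ (x ∷_) ∘ zipWith _∷_ c) Tₙ)) Cᵣ)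

  fold-noneSet : ∀ r (H : Vec Bool r → Carrier) →
    fold (map (λ c → if noneSet c then H c else ε) (allTuples r bools)) ≈ H (replicate r false)
  fold-noneSet zero    H = identityʳ _
  fold-noneSet (suc r) H = begin
    fold (map (λ c → if noneSet c then H c else ε) (allTuples (suc r) bools))
      ≈⟨ fold-allTuples-suc bools (λ c → if noneSet c then H c else ε) ⟩
    fold (map (λ c → if noneSet c then H (false ∷ c) else ε) (allTuples r bools))
      ∙ (fold (map (λ _ → ε) (allTuples r bools)) ∙ ε)
      ≈⟨ ∙-cong (fold-noneSet r (H ∘ (false ∷_))) (trans (identityʳ _) (fold-ε (λ _ → refl) (allTuples r bools))) ⟩
    H (false ∷ replicate r false) ∙ ε
      ≈⟨ identityʳ _ ⟩
    H (replicate (suc r) false) ∎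

  fold-units : ∀ r (X : Vec Bool r → Carrier) → (∀ c → isUnit c ≡ false → X c ≈ ε) →
    fold (map X (allTuples r bools)) ≈ fold (map (X ∘ unit r) (upTo r))
  fold-units zero    X nonUnit = trans (identityʳ _) (nonUnit [] ≡.refl)
  fold-units (suc r) X nonUnit = begin
    fold (map X (allTuples (suc r) bools))
      ≈⟨ fold-allTuples-suc bools X ⟩
    fold (map (X ∘ (false ∷_)) (allTuples r bools)) ∙ (fold (map (X ∘ (true ∷_)) (allTuples r bools)) ∙ ε)
      ≈⟨ ∙-cong (fold-units r (X ∘ (false ∷_)) (nonUnit ∘ (false ∷_)))
                (trans (identityʳ _) (trans (fold-cong unitOrε (allTuples r bools)) (fold-noneSet r (X ∘ (true ∷_))))) ⟩
    fold (map (X ∘ (false ∷_) ∘ unit r) (upTo r)) ∙ X (unit (suc r) 0)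
      ≈⟨ comm _ _ ⟩
    X (unit (suc r) 0) ∙ fold (map (X ∘ unit (suc r) ∘ suc) (upTo r))
      ≡⟨ ≡.cong fold (map-upTo-suc (X ∘ unit (suc r)) r) ⟨
    fold (map (X ∘ unit (suc r)) (upTo (suc r))) ∎
    where
    unitOrε : ∀ c → X (true ∷ c) ≈ (if noneSet c then X (true ∷ c) else ε)
    unitOrε c with noneSet c in eq
    ... | true  = refl
    ... | false = nonUnit (true ∷ c) eq

module ShadowedRecursion where
  open ≡ using (refl; sym; trans; cong; cong₂)
  open Nat using (_+_)
  open FoldProperties ℕₚ.+-0-commutativeMonoid using ()
    renaming (fold-ε to sum-zero; fold-∙ to sum-+; fold-imap-zipWith-∷ to sum-imap-zipWith-∷;
              fold-imap-none to sum-imap-none; fold-imap-unit to sum-imap-unit)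
  open FoldProperties Boolₚ.∧-commutativeMonoid using ()
    renaming (fold-imap-zipWith-∷ to and-imap-zipWith-∷; fold-imap-none to and-imap-none; fold-imap-unit to and-imap-unit)

  𝟙 : Bool → ℕ
  𝟙 true  = 1
  𝟙 false = 0

  rowCover : ℕ → Vec Bool n → ℕ → ℕ
  rowCover k v x = sum (map (λ j → 𝟙 ((j ≤ᵇ x) ∧ mem v (x ∸ j))) (upTo (suc k)))

  cover : Vec (Vec Bool n) r → ℕ → ℕ
  cover S x = sum (imap (λ k v → rowCover k v x) S)

  mutual
    coverCount≡cover : (S : Vec (Vec Bool n) r) (x : ℕ) → coverCount S x ≡ cover S x
    coverCount≡cover {r = r} S x =
      trans (cong sum (Listₚ.map-cong (λ i → cong sum (Listₚ.map-cong (coverCount-term S x i) (upTo (suc (toℕ i)))))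
                                      (allFin r)))
            (cong sum (map-allFin-lookup (λ k v → rowCover k v x) S))

    -- coverCount counts with an indicator private to Defs; it agrees with 𝟙 case by case.
    coverCount-term : (S : Vec (Vec Bool n) r) (x : ℕ) (i : Fin r) (j : ℕ) → _ ≡ 𝟙 (inShift S i j x)
    coverCount-term S x i j with inShift S i j x
    ... | true  = refl
    ... | false = refl

  count-≡ᵇ : ∀ b k y → sum (map (λ j → 𝟙 ((j ≡ᵇ y) ∧ b)) (upTo (suc k))) ≡ 𝟙 ((y ≤ᵇ k) ∧ b)
  count-≡ᵇ b k y = trans (cong sum (map-upTo-suc (λ j → 𝟙 ((j ≡ᵇ y) ∧ b)) k)) (split k y)
    where
    split : ∀ k y → 𝟙 ((0 ≡ᵇ y) ∧ b) + sum (map (λ j → 𝟙 ((suc j ≡ᵇ y) ∧ b)) (upTo k)) ≡ 𝟙 ((y ≤ᵇ k) ∧ b)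
    split k       zero    = trans (cong (_+_ (𝟙 b)) (sum-zero (λ _ → refl) (upTo k))) (ℕₚ.+-identityʳ _)
    split zero    (suc y) = refl
    split (suc k) (suc y) = trans (count-≡ᵇ b k y) (cong (λ z → 𝟙 (z ∧ b)) (sym (<ᵇ-suc y k)))

  mem-∷-shift : ∀ j x b (w : Vec Bool n) →
    𝟙 ((j ≤ᵇ suc x) ∧ mem (b ∷ w) (suc x ∸ j)) ≡ 𝟙 ((j ≤ᵇ x) ∧ mem w (x ∸ j)) + 𝟙 ((j ≡ᵇ suc x) ∧ b)
  mem-∷-shift zero          x       b w = sym (ℕₚ.+-identityʳ _)
  mem-∷-shift (suc zero)    zero    b w = refl
  mem-∷-shift (suc (suc j)) zero    b w = refl
  mem-∷-shift (suc j)       (suc x) b w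
    rewrite <ᵇ-suc j (suc x) | <ᵇ-suc j x = mem-∷-shift j x b w

  rowCover-∷-zero : ∀ k b (w : Vec Bool n) → rowCover k (b ∷ w) 0 ≡ 𝟙 b
  rowCover-∷-zero k b w = trans (cong sum (map-upTo-suc (λ j → 𝟙 ((j ≤ᵇ 0) ∧ mem (b ∷ w) (0 ∸ j))) k))
                                (trans (cong (_+_ (𝟙 b)) (sum-zero (λ _ → refl) (upTo k))) (ℕₚ.+-identityʳ _))

  rowCover-∷-suc : ∀ k b (w : Vec Bool n) x → rowCover k (b ∷ w) (suc x) ≡ 𝟙 ((suc x ≤ᵇ k) ∧ b) + rowCover k w x
  rowCover-∷-suc k b w x = begin
    rowCover k (b ∷ w) (suc x)
      ≡⟨ cong sum (Listₚ.map-cong (λ j → mem-∷-shift j x b w) (upTo (suc k))) ⟩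
    sum (map (λ j → 𝟙 ((j ≤ᵇ x) ∧ mem w (x ∸ j)) + 𝟙 ((j ≡ᵇ suc x) ∧ b)) (upTo (suc k)))
      ≡⟨ sum-+ (λ j → 𝟙 ((j ≤ᵇ x) ∧ mem w (x ∸ j))) (λ j → 𝟙 ((j ≡ᵇ suc x) ∧ b)) (upTo (suc k)) ⟩
    rowCover k w x + sum (map (λ j → 𝟙 ((j ≡ᵇ suc x) ∧ b)) (upTo (suc k)))
      ≡⟨ cong (_+_ (rowCover k w x)) (count-≡ᵇ b k (suc x)) ⟩
    rowCover k w x + 𝟙 ((suc x ≤ᵇ k) ∧ b)
      ≡⟨ ℕₚ.+-comm (rowCover k w x) _ ⟩
    𝟙 ((suc x ≤ᵇ k) ∧ b) + rowCover k w x ∎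
    where open ≡-Reasoning

  popcount : Vec Bool r → ℕ
  popcount c = sum (imap (λ _ → 𝟙) c)

  countAbove : ℕ → Vec Bool r → ℕ
  countAbove x c = sum (imap (λ k b → 𝟙 ((suc x ≤ᵇ k) ∧ b)) c)

  cover-zipWith-zero : (c : Vec Bool r) (S : Vec (Vec Bool n) r) → cover (zipWith _∷_ c S) 0 ≡ popcount c
  cover-zipWith-zero c S =
    trans (sum-imap-zipWith-∷ (λ k b v → trans (rowCover-∷-zero k b v) (sym (ℕₚ.+-identityʳ _))) c S)
          (trans (cong (_+_ (popcount c)) (sum-imap-zero S)) (ℕₚ.+-identityʳ _))
    where
    sum-imap-zero : ∀ {n r} (S : Vec (Vec Bool n) r) → sum (imap (λ _ _ → 0) S) ≡ 0
    sum-imap-zero []      = refl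
    sum-imap-zero (v ∷ S) = sum-imap-zero S

  cover-zipWith-suc : (c : Vec Bool r) (S : Vec (Vec Bool n) r) (x : ℕ) →
    cover (zipWith _∷_ c S) (suc x) ≡ countAbove x c + cover S x
  cover-zipWith-suc c S x = sum-imap-zipWith-∷ (λ k b v → rowCover-∷-suc k b v x) c S

  popcount≢0 : (c : Vec Bool r) → noneSet c ≡ false → (popcount c ≡ᵇ 0) ≡ false
  popcount≢0 (true ∷ c)  _  = refl
  popcount≢0 (false ∷ c) eq = popcount≢0 c eq

  popcount≢1 : (c : Vec Bool r) → isUnit c ≡ false → (popcount c ≡ᵇ 1) ≡ false
  popcount≢1 []          _  = refl
  popcount≢1 (true ∷ c)  eq = popcount≢0 c eq
  popcount≢1 (false ∷ c) eq = popcount≢1 c eq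

  rowBounded : ℕ → Vec Bool n → Bool
  rowBounded {n} k v = all (λ s → not (mem v s) ∨ (s + k <ᵇ n)) (upTo n)

  bounded : Vec (Vec Bool n) r → Bool
  bounded S = and (imap rowBounded S)

  columnBounded : ℕ → Vec Bool r → Bool
  columnBounded n c = and (imap (λ k b → not b ∨ (k <ᵇ suc n)) c)

  bounded-zipWith : (c : Vec Bool r) (S : Vec (Vec Bool n) r) → bounded (zipWith _∷_ c S) ≡ columnBounded n c ∧ bounded S
  bounded-zipWith {n = n} =
    and-imap-zipWith-∷ (λ k b v → all-upTo-suc (λ s → not (mem (b ∷ v) s) ∨ (s + k <ᵇ suc n)) n)

  bounded-empty : (S : Vec (Vec Bool 0) r) → bounded S ≡ true
  bounded-empty []       = refl
  bounded-empty ([] ∷ S) = bounded-empty S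

  coveredOnce : ℕ → Vec (Vec Bool n) r → Bool
  coveredOnce {n} p S = all (λ x → 𝟙 (x <ᵇ p) + cover S x ≡ᵇ 1) (upTo n)

  -- The sets S_i + j partition {p,…,n−1}; positions below p count as covered already.
  isShadowedFrom : ℕ → Vec (Vec Bool n) r → Bool
  isShadowedFrom {n} p S = bounded S ∧ (coveredOnce p S ∧ (p ≤ᵇ n))

  isShadowed≡isShadowedFrom-0 : (S : Vec (Vec Bool n) r) → isShadowed S ≡ isShadowedFrom 0 S
  isShadowed≡isShadowedFrom-0 {n} {r} S = cong₂ _∧_
    (trans (all≡and∘map _ (allFin r)) (cong and (map-allFin-lookup rowBounded S)))
    (trans (all-cong (λ x → cong (_≡ᵇ 1) (coverCount≡cover S x)) (upTo n)) (sym (Boolₚ.∧-identityʳ _)))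

  coveredOnce-zipWith : ∀ p (c : Vec Bool r) (S : Vec (Vec Bool n) r) →
    coveredOnce p (zipWith _∷_ c S) ≡
    (𝟙 (0 <ᵇ p) + popcount c ≡ᵇ 1) ∧ all (λ x → 𝟙 (suc x <ᵇ p) + (countAbove x c + cover S x) ≡ᵇ 1) (upTo n)
  coveredOnce-zipWith {n = n} p c S = trans (all-upTo-suc _ n) (cong₂ _∧_
    (cong (λ m → 𝟙 (0 <ᵇ p) + m ≡ᵇ 1) (cover-zipWith-zero c S))
    (all-cong (λ x → cong (λ m → 𝟙 (suc x <ᵇ p) + m ≡ᵇ 1) (cover-zipWith-suc c S x)) (upTo n)))

  coveredOnce-suc-none : ∀ p (c : Vec Bool r) (S : Vec (Vec Bool n) r) → noneSet c ≡ true →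
    coveredOnce (suc p) (zipWith _∷_ c S) ≡ coveredOnce p S
  coveredOnce-suc-none {n = n} p c S none = trans (coveredOnce-zipWith (suc p) c S) (cong₂ _∧_
    (cong (λ m → suc m ≡ᵇ 1) (sum-imap-none {G = λ _ → 𝟙} (λ _ → refl) c none))
    (all-cong (λ x → cong (λ m → 𝟙 (x <ᵇ p) + (m + cover S x) ≡ᵇ 1)
                          (sum-imap-none {G = λ k b → 𝟙 ((suc x ≤ᵇ k) ∧ b)} (λ _ → cong 𝟙 (Boolₚ.∧-zeroʳ _)) c none))
              (upTo n)))

  coveredOnce-suc-some : ∀ p (c : Vec Bool r) (S : Vec (Vec Bool n) r) → noneSet c ≡ false →
    coveredOnce (suc p) (zipWith _∷_ c S) ≡ false
  coveredOnce-suc-some {n = n} p c S some = trans (coveredOnce-zipWith (suc p) c S)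
    (cong (_∧ all (λ x → 𝟙 (x <ᵇ p) + (countAbove x c + cover S x) ≡ᵇ 1) (upTo n)) (popcount≢0 c some))

  coveredOnce-zero-unit : ∀ {k} (S : Vec (Vec Bool n) r) → k < r →
    coveredOnce 0 (zipWith _∷_ (unit r k) S) ≡ coveredOnce k S
  coveredOnce-zero-unit {n} {r} {k} S k<r = trans (coveredOnce-zipWith 0 (unit r k) S) (cong₂ _∧_
    (cong (_≡ᵇ 1) (sum-imap-unit {G = λ _ → 𝟙} (λ _ → refl) k<r))
    (all-cong (λ x → cong (λ m → m + cover S x ≡ᵇ 1)
                          (trans (sum-imap-unit {G = λ k b → 𝟙 ((suc x ≤ᵇ k) ∧ b)} (λ _ → cong 𝟙 (Boolₚ.∧-zeroʳ _)) k<r)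
                                 (cong 𝟙 (Boolₚ.∧-identityʳ (x <ᵇ k)))))
              (upTo n)))

  coveredOnce-zero-nonUnit : (c : Vec Bool r) (S : Vec (Vec Bool n) r) → isUnit c ≡ false →
    coveredOnce 0 (zipWith _∷_ c S) ≡ false
  coveredOnce-zero-nonUnit {n = n} c S nonUnit = trans (coveredOnce-zipWith 0 c S)
    (cong (_∧ all (λ x → countAbove x c + cover S x ≡ᵇ 1) (upTo n)) (popcount≢1 c nonUnit))

  isShadowedFrom-suc-zipWith : ∀ p (c : Vec Bool r) (S : Vec (Vec Bool n) r) →
    isShadowedFrom (suc p) (zipWith _∷_ c S) ≡ noneSet c ∧ isShadowedFrom p S
  isShadowedFrom-suc-zipWith {n = n} p c S with noneSet c in none
  ... | true  = begin
    bounded (zipWith _∷_ c S) ∧ (coveredOnce (suc p) (zipWith _∷_ c S) ∧ (p <ᵇ suc n))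
      ≡⟨ cong₂ (λ u v → u ∧ (v ∧ (p <ᵇ suc n)))
               (trans (bounded-zipWith c S)
                      (cong (_∧ bounded S) (and-imap-none {G = λ k b → not b ∨ (k <ᵇ suc n)} (λ _ → refl) c none)))
               (coveredOnce-suc-none p c S none) ⟩
    bounded S ∧ (coveredOnce p S ∧ (p <ᵇ suc n))
      ≡⟨ cong (λ u → bounded S ∧ (coveredOnce p S ∧ u)) (<ᵇ-suc p n) ⟩
    isShadowedFrom p S ∎
    where open ≡-Reasoning
  ... | false = trans (cong (λ v → bounded (zipWith _∷_ c S) ∧ (v ∧ _)) (coveredOnce-suc-some p c S none))
                      (Boolₚ.∧-zeroʳ _)

  isShadowedFrom-zero-zipWith : (c : Vec Bool r) (S : Vec (Vec Bool n) r) →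
    isShadowedFrom 0 (zipWith _∷_ c S) ≡ unitAnd c (λ k → isShadowedFrom k S)
  isShadowedFrom-zero-zipWith {r} {n} c S with isUnit c in isUnit-c
  ... | false = trans (cong (λ v → bounded (zipWith _∷_ c S) ∧ (v ∧ true)) (coveredOnce-zero-nonUnit c S isUnit-c))
                      (trans (Boolₚ.∧-zeroʳ _) (sym (unitAnd-nonUnit c isUnit-c _)))
  ... | true with isUnit⇒unit c isUnit-c
  ...   | k , k<r , refl = begin
    bounded (zipWith _∷_ (unit r k) S) ∧ (coveredOnce 0 (zipWith _∷_ (unit r k) S) ∧ true)
      ≡⟨ cong₂ (λ u v → u ∧ (v ∧ true))
               (trans (bounded-zipWith (unit r k) S)
                      (cong (_∧ bounded S) (and-imap-unit {G = λ k b → not b ∨ (k <ᵇ suc n)} (λ _ → refl) k<r)))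
               (coveredOnce-zero-unit S k<r) ⟩
    ((k <ᵇ suc n) ∧ bounded S) ∧ (coveredOnce k S ∧ true)
      ≡⟨ ∧-shuffle (k <ᵇ suc n) (bounded S) (coveredOnce k S) ⟩
    bounded S ∧ (coveredOnce k S ∧ (k <ᵇ suc n))
      ≡⟨ cong (λ u → bounded S ∧ (coveredOnce k S ∧ u)) (<ᵇ-suc k n) ⟩
    isShadowedFrom k S
      ≡⟨ unitAnd-unit k<r (λ k → isShadowedFrom k S) ⟨
    unitAnd (unit r k) (λ k → isShadowedFrom k S) ∎
    where
    open ≡-Reasoning
    ∧-shuffle : ∀ a b c → (a ∧ b) ∧ (c ∧ true) ≡ b ∧ (c ∧ a)
    ∧-shuffle true  b c = refl
    ∧-shuffle false b c = sym (trans (cong (b ∧_) (Boolₚ.∧-zeroʳ c)) (Boolₚ.∧-zeroʳ b))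

  -- isShadowedFrom read column by column: while p positions are still covered by an open block
  -- the column is empty; otherwise it is a unit vector e_k, opening a block S_{k+1} that covers
  -- this position and the next k.
  shadowed : ℕ → Vec (Vec Bool n) r → Bool
  shadowed {zero}  p       S = p ≡ᵇ 0
  shadowed {suc n} zero    S = unitAnd (Vec.map head S) (λ k → shadowed k (Vec.map tail S))
  shadowed {suc n} (suc p) S = noneSet (Vec.map head S) ∧ shadowed p (Vec.map tail S)

  isShadowedFrom≡shadowed : ∀ n p (S : Vec (Vec Bool n) r) → isShadowedFrom p S ≡ shadowed p S
  isShadowedFrom≡shadowed zero    zero    S = cong (_∧ true) (bounded-empty S)
  isShadowedFrom≡shadowed zero    (suc p) S = cong (_∧ false) (bounded-empty S)
  isShadowedFrom≡shadowed (suc n) p       S =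
    trans (cong (isShadowedFrom p) (sym (zipWith-∷-head-tail S))) (column p)
    where
    column : ∀ p → isShadowedFrom p (zipWith _∷_ (Vec.map head S) (Vec.map tail S)) ≡ shadowed p S
    column zero    = trans (isShadowedFrom-zero-zipWith (Vec.map head S) (Vec.map tail S))
                           (unitAnd-cong (Vec.map head S) (λ k → isShadowedFrom≡shadowed n k (Vec.map tail S)))
    column (suc p) = trans (isShadowedFrom-suc-zipWith p (Vec.map head S) (Vec.map tail S))
                           (cong (noneSet (Vec.map head S) ∧_) (isShadowedFrom≡shadowed n p (Vec.map tail S)))

  isShadowed≡shadowed : (S : Vec (Vec Bool n) r) → isShadowed S ≡ shadowed 0 S
  isShadowed≡shadowed {n} S = trans (isShadowed≡isShadowedFrom-0 S) (isShadowedFrom≡shadowed n 0 S)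

  shadowed-zipWith-zero : (c : Vec Bool r) (S : Vec (Vec Bool n) r) →
    shadowed 0 (zipWith _∷_ c S) ≡ unitAnd c (λ k → shadowed k S)
  shadowed-zipWith-zero c S =
    cong₂ (λ c′ S′ → unitAnd c′ (λ k → shadowed k S′)) (head-zipWith-∷ c S) (tail-zipWith-∷ c S)

  shadowed-zipWith-suc : ∀ p (c : Vec Bool r) (S : Vec (Vec Bool n) r) →
    shadowed (suc p) (zipWith _∷_ c S) ≡ noneSet c ∧ shadowed p S
  shadowed-zipWith-suc p c S =
    cong₂ (λ c′ S′ → noneSet c′ ∧ shadowed p S′) (head-zipWith-∷ c S) (tail-zipWith-∷ c S)

module WeightedCount {c ℓ} (R : CommutativeSemiring c ℓ) (r : ℕ) where
  open CommutativeSemiring R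
  open import Relation.Binary.Reasoning.Setoid setoid
  open CommutativeSemigroupProperties *-commutativeSemigroup using (x∙yz≈y∙xz)
  open ShadowedRecursion using (shadowed; isShadowed≡shadowed; shadowed-zipWith-zero; shadowed-zipWith-suc)
  open FoldProperties +-commutativeMonoid using ()
    renaming (fold to ∑; fold-cong to ∑-cong; fold-ε to ∑-zero; fold-∙ to ∑-+; fold-comm to ∑-comm;
              fold-cong-upTo to ∑-cong-upTo; fold-if to ∑-if; fold-filterᵇ to ∑-filterᵇ; fold-columns to ∑-columns;
              fold-noneSet to ∑-noneSet; fold-units to ∑-units; fold-allTuples-singleton to ∑-allTuples-singleton)
  open FoldProperties *-commutativeMonoid using ()
    renaming (fold to ∏; fold-cong to ∏-cong; fold-ε to ∏-one; fold-filterᵇ to ∏-filterᵇ;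
              fold-imap-zipWith-∷ to ∏-imap-zipWith-∷; fold-imap-none to ∏-imap-none; fold-imap-unit to ∏-imap-unit)

  ∑-*ˡ : (a : Carrier) (f : A → Carrier) → ∀ xs → ∑ (map (λ x → a * f x) xs) ≈ a * ∑ (map f xs)
  ∑-*ˡ a f []       = sym (zeroʳ a)
  ∑-*ˡ a f (x ∷ xs) = trans (+-cong refl (∑-*ˡ a f xs)) (sym (distribˡ a (f x) _))

  ∑-fromTo-1 : (f : ℕ → Carrier) → ∑ (map f (fromTo 1 r)) ≡ ∑ (map (f ∘ suc) (upTo r))
  ∑-fromTo-1 f = ≡.cong ∑ (≡.sym (Listₚ.map-∘ (upTo r)))

  ∑-cong-fromTo-1 : {f f′ : ℕ → Carrier} → (∀ k → f (suc k) ≈ f′ (suc k)) →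
    ∑ (map f (fromTo 1 r)) ≈ ∑ (map f′ (fromTo 1 r))
  ∑-cong-fromTo-1 {f} {f′} f≈f′ = begin
    ∑ (map f (fromTo 1 r))         ≡⟨ ∑-fromTo-1 f ⟩
    ∑ (map (f ∘ suc) (upTo r))     ≈⟨ ∑-cong f≈f′ (upTo r) ⟩
    ∑ (map (f′ ∘ suc) (upTo r))    ≡⟨ ∑-fromTo-1 f′ ⟨
    ∑ (map f′ (fromTo 1 r))        ∎

  if-cong : ∀ b {x y} → x ≈ y → (if b then x else 0#) ≈ (if b then y else 0#)
  if-cong true  x≈y = x≈y
  if-cong false _   = refl

  if-∧ : ∀ a b (x : Carrier) → (if a then (if b then x else 0#) else 0#) ≡ (if a ∧ b then x else 0#)
  if-∧ true  b x = ≡.refl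
  if-∧ false b x = ≡.refl

  *-if : ∀ b a x → a * (if b then x else 0#) ≈ (if b then a * x else 0#)
  *-if true  a x = refl
  *-if false a x = zeroʳ a

  δ : ℕ → Carrier
  δ n = if n ≡ᵇ 0 then 1# else 0#

  -- f (n − k), read as 0 when k > n, like 𝓑 at negative indices.  Opaque, so that unification
  -- keeps seeing f in the lemmas below.
  infix 8 _⦅_∸_⦆
  opaque
    _⦅_∸_⦆ : (ℕ → Carrier) → ℕ → ℕ → Carrier
    f ⦅ n ∸ k ⦆ = if k ≤ᵇ n then f (n ∸ k) else 0#

  opaque
    unfolding _⦅_∸_⦆

    ⦅⦆-≤ : (f : ℕ → Carrier) {n k : ℕ} → k ≤ n → f ⦅ n ∸ k ⦆ ≡ f (n ∸ k)
    ⦅⦆-≤ f {n} {k} k≤n = ≡.cong (λ b → if b then f (n ∸ k) else 0#) (dec-true (k ℕₚ.≤? n) k≤n)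

    ⦅⦆-> : (f : ℕ → Carrier) {n k : ℕ} → n < k → f ⦅ n ∸ k ⦆ ≡ 0#
    ⦅⦆-> f {n} {k} n<k = ≡.cong (λ b → if b then f (n ∸ k) else 0#) (dec-false (k ℕₚ.≤? n) (ℕₚ.<⇒≱ n<k))

    ⦅⦆-cong : ∀ {f f′ : ℕ → Carrier} n k → f (n ∸ k) ≈ f′ (n ∸ k) → f ⦅ n ∸ k ⦆ ≈ f′ ⦅ n ∸ k ⦆
    ⦅⦆-cong n k = if-cong (k ≤ᵇ n)

    ⦅⦆-suc : (f : ℕ → Carrier) (n k : ℕ) → f ⦅ suc n ∸ suc k ⦆ ≡ f ⦅ n ∸ k ⦆
    ⦅⦆-suc f n k = ≡.cong (λ b → if b then f (n ∸ k) else 0#) (<ᵇ-suc k n)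

    *-⦅⦆ : (a : Carrier) (f : ℕ → Carrier) (n k : ℕ) → a * f ⦅ n ∸ k ⦆ ≈ (λ i → a * f i) ⦅ n ∸ k ⦆
    *-⦅⦆ a f n k = *-if (k ≤ᵇ n) a (f (n ∸ k))

    ⦅⦆-distrib : (a d : ℕ → Carrier) (F : ℕ → A → Carrier) (xs : List A) (n k : ℕ) →
      (λ i → a i * (d i + ∑ (map (F i) xs))) ⦅ n ∸ k ⦆ ≈
      (λ i → a i * d i) ⦅ n ∸ k ⦆ + ∑ (map (λ x → (λ i → a i * F i x) ⦅ n ∸ k ⦆) xs)
    ⦅⦆-distrib a d F xs n k with k ≤ᵇ n
    ... | true  = trans (distribˡ _ _ _) (+-cong refl (sym (∑-*ˡ _ (F (n ∸ k)) xs)))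
    ... | false = sym (trans (+-identityˡ _) (∑-zero (λ _ → refl) xs))

    ⦅⦆-swap : (h : ℕ → ℕ → Carrier) (n k l : ℕ) →
      (λ i → (λ j → h (k Nat.+ j) j) ⦅ i ∸ l ⦆) ⦅ n ∸ k ⦆ ≈ (λ i → (λ j → h i j) ⦅ i ∸ k ⦆) ⦅ n ∸ l ⦆
    ⦅⦆-swap h n k l = begin
      (λ i → (λ j → h (k Nat.+ j) j) ⦅ i ∸ l ⦆) ⦅ n ∸ k ⦆
        ≡⟨ if-∧ (k ≤ᵇ n) (l ≤ᵇ n ∸ k) _ ⟩
      (if (k ≤ᵇ n) ∧ (l ≤ᵇ n ∸ k) then h (k Nat.+ (n ∸ k ∸ l)) (n ∸ k ∸ l) else 0#)
        ≡⟨ ≡.cong (λ b → if b then h (k Nat.+ (n ∸ k ∸ l)) (n ∸ k ∸ l) else 0#) (≤ᵇ-∧-∸ n k l) ⟩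
      (if k Nat.+ l ≤ᵇ n then h (k Nat.+ (n ∸ k ∸ l)) (n ∸ k ∸ l) else 0#)
        ≡⟨ reindex ⟩
      (if k Nat.+ l ≤ᵇ n then h (n ∸ l) (n ∸ l ∸ k) else 0#)
        ≡⟨ ≡.cong (λ b → if b then h (n ∸ l) (n ∸ l ∸ k) else 0#)
                  (≡.trans (≡.cong (_≤ᵇ n) (ℕₚ.+-comm k l)) (≡.sym (≤ᵇ-∧-∸ n l k))) ⟩
      (if (l ≤ᵇ n) ∧ (k ≤ᵇ n ∸ l) then h (n ∸ l) (n ∸ l ∸ k) else 0#)
        ≡⟨ if-∧ (l ≤ᵇ n) (k ≤ᵇ n ∸ l) _ ⟨
      (λ i → (λ j → h i j) ⦅ i ∸ k ⦆) ⦅ n ∸ l ⦆ ∎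
      where
      reindex : (if k Nat.+ l ≤ᵇ n then h (k Nat.+ (n ∸ k ∸ l)) (n ∸ k ∸ l) else 0#) ≡
                (if k Nat.+ l ≤ᵇ n then h (n ∸ l) (n ∸ l ∸ k) else 0#)
      reindex with k Nat.+ l ≤ᵇ n in k+l≤ᵇn
      ... | false = ≡.refl
      ... | true  = ≡.cong₂ h (+-∸-∸ {n} {k} {l} (ℕₚ.≤ᵇ⇒≤ (k Nat.+ l) n (≡.subst T (≡.sym k+l≤ᵇn) _)))
                              (∸-∸-comm n k l)

  shiftBy : ℕ → (ℕ → ℕ → Carrier) → ℕ → ℕ → Carrier
  shiftBy p g i j = g i (p Nat.+ j)

  -- The summand of 𝓑ℕ, with g i j in place of A_i^{q^j}/(t − θ^{q^{i+j}}).
  weight : (ℕ → ℕ → Carrier) → Vec (Vec Bool n) r → Carrier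
  weight {n} g S = ∏ (map (λ i → ∏ (map (g (suc (toℕ i))) (filterᵇ (mem (lookup S i)) (upTo n)))) (allFin r))

  shadowSum : ℕ → (ℕ → ℕ → Carrier) → ℕ → Carrier
  shadowSum p g n = ∑ (map (λ S → if shadowed p S then weight g S else 0#) (allTuples r (allSubsets n)))

  𝓖 : (ℕ → ℕ → Carrier) → ℕ → Carrier
  𝓖 = shadowSum 0

  rowWeight : (ℕ → Carrier) → Vec Bool n → Carrier
  rowWeight {n} h v = ∏ (map (λ j → if mem v j then h j else 1#) (upTo n))

  columnWeight : (ℕ → ℕ → Carrier) → Vec Bool r → Carrier
  columnWeight g c = ∏ (imap (λ k b → if b then g (suc k) 0 else 1#) c)

  weight≈∏rowWeight : (g : ℕ → ℕ → Carrier) (S : Vec (Vec Bool n) r) →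
    weight g S ≈ ∏ (imap (λ k → rowWeight (g (suc k))) S)
  weight≈∏rowWeight {n} g S =
    trans (∏-cong (λ i → ∏-filterᵇ (mem (lookup S i)) (g (suc (toℕ i))) (upTo n)) (allFin r))
          (reflexive (≡.cong ∏ (map-allFin-lookup (λ k → rowWeight (g (suc k))) S)))

  weight-zipWith : (g : ℕ → ℕ → Carrier) (c : Vec Bool r) (S : Vec (Vec Bool n) r) →
    weight g (zipWith _∷_ c S) ≈ columnWeight g c * weight (shiftBy 1 g) S
  weight-zipWith {n} g c S = begin
    weight g (zipWith _∷_ c S)
      ≈⟨ weight≈∏rowWeight g (zipWith _∷_ c S) ⟩
    ∏ (imap (λ k → rowWeight (g (suc k))) (zipWith _∷_ c S))
      ≈⟨ ∏-imap-zipWith-∷ (λ k b v → reflexive (≡.cong ∏ (map-upTo-suc (λ j → if mem (b ∷ v) j then g (suc k) j else 1#) n)))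
                          c S ⟩
    columnWeight g c * ∏ (imap (λ k → rowWeight (shiftBy 1 g (suc k))) S)
      ≈⟨ *-cong refl (weight≈∏rowWeight (shiftBy 1 g) S) ⟨
    columnWeight g c * weight (shiftBy 1 g) S ∎

  weight-cong : {g g′ : ℕ → ℕ → Carrier} → (∀ i j → g i j ≈ g′ i j) →
    (S : Vec (Vec Bool n) r) → weight g S ≈ weight g′ S
  weight-cong {n} g≈g′ S =
    ∏-cong (λ i → ∏-cong (g≈g′ (suc (toℕ i))) (filterᵇ (mem (lookup S i)) (upTo n))) (allFin r)

  ∑-weight-P : ∀ g n → ∑ (map (weight g) (P r n)) ≈ 𝓖 g n
  ∑-weight-P g n = trans (∑-filterᵇ isShadowed (weight g) (allTuples r (allSubsets n)))
    (∑-cong (λ S → reflexive (≡.cong (λ b → if b then weight g S else 0#) (isShadowed≡shadowed S)))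
            (allTuples r (allSubsets n)))

  shadowSum-zero : ∀ p g → shadowSum p g 0 ≈ (if p ≡ᵇ 0 then 1# else 0#)
  shadowSum-zero p g = trans (∑-allTuples-singleton r [] _) (if-cong (p ≡ᵇ 0) (∏-one (λ _ → refl) (allFin r)))

  shadowSum-suc-suc : ∀ p g n → shadowSum (suc p) g (suc n) ≈ shadowSum p (shiftBy 1 g) n
  shadowSum-suc-suc p g n = begin
    shadowSum (suc p) g (suc n)
      ≈⟨ ∑-columns r (λ S → if shadowed (suc p) S then weight g S else 0#) ⟩
    ∑ (map (λ c → ∑ (map (λ S → if shadowed (suc p) (zipWith _∷_ c S) then weight g (zipWith _∷_ c S) else 0#) Tₙ)) Cᵣ)
      ≈⟨ ∑-cong (λ c → trans (∑-cong (column c) Tₙ) (∑-if (noneSet c) (term c) Tₙ)) Cᵣ ⟩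
    ∑ (map (λ c → if noneSet c then ∑ (map (term c) Tₙ) else 0#) Cᵣ)
      ≈⟨ ∑-noneSet r (λ c → ∑ (map (term c) Tₙ)) ⟩
    ∑ (map (term (replicate r false)) Tₙ)
      ≈⟨ ∑-cong (λ S → if-cong (shadowed p S) (trans (*-cong columnWeight-none refl) (*-identityˡ _))) Tₙ ⟩
    shadowSum p (shiftBy 1 g) n ∎
    where
    Tₙ : List (Vec (Vec Bool n) r)
    Tₙ = allTuples r (allSubsets n)
    Cᵣ : List (Vec Bool r)
    Cᵣ = allTuples r bools
    term : Vec Bool r → Vec (Vec Bool n) r → Carrier
    term c S = if shadowed p S then columnWeight g c * weight (shiftBy 1 g) S else 0#
    column : ∀ c S → (if shadowed (suc p) (zipWith _∷_ c S) then weight g (zipWith _∷_ c S) else 0#) ≈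
                     (if noneSet c then term c S else 0#)
    column c S = begin
      (if shadowed (suc p) (zipWith _∷_ c S) then weight g (zipWith _∷_ c S) else 0#)
        ≡⟨ ≡.cong (λ b → if b then weight g (zipWith _∷_ c S) else 0#) (shadowed-zipWith-suc p c S) ⟩
      (if noneSet c ∧ shadowed p S then weight g (zipWith _∷_ c S) else 0#)
        ≡⟨ if-∧ (noneSet c) (shadowed p S) _ ⟨
      (if noneSet c then (if shadowed p S then weight g (zipWith _∷_ c S) else 0#) else 0#)
        ≈⟨ if-cong (noneSet c) (if-cong (shadowed p S) (weight-zipWith g c S)) ⟩
      (if noneSet c then term c S else 0#) ∎
    columnWeight-none : columnWeight g (replicate r false) ≈ 1#
    columnWeight-none = ∏-imap-none (λ _ → refl) (replicate r false) (noneSet-replicate r)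

  𝓖-suc : ∀ g n → 𝓖 g (suc n) ≈ ∑ (map (λ k → g (suc k) 0 * shadowSum k (shiftBy 1 g) n) (upTo r))
  𝓖-suc g n = begin
    𝓖 g (suc n)                       ≈⟨ ∑-columns r (λ S → if shadowed 0 S then weight g S else 0#) ⟩
    ∑ (map X (allTuples r bools))      ≈⟨ ∑-units r X nonUnit ⟩
    ∑ (map (X ∘ unit r) (upTo r))      ≈⟨ ∑-cong-upTo r atUnit ⟩
    ∑ (map (λ k → g (suc k) 0 * shadowSum k (shiftBy 1 g) n) (upTo r)) ∎
    where
    Tₙ : List (Vec (Vec Bool n) r)
    Tₙ = allTuples r (allSubsets n)
    X : Vec Bool r → Carrier
    X c = ∑ (map (λ S → if shadowed 0 (zipWith _∷_ c S) then weight g (zipWith _∷_ c S) else 0#) Tₙ)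
    nonUnit : ∀ c → isUnit c ≡ false → X c ≈ 0#
    nonUnit c nonUnit-c = ∑-zero (λ S → reflexive (≡.cong (λ b → if b then weight g (zipWith _∷_ c S) else 0#)
      (≡.trans (shadowed-zipWith-zero c S) (unitAnd-nonUnit c nonUnit-c _)))) Tₙ
    atUnit : ∀ k → k < r → X (unit r k) ≈ g (suc k) 0 * shadowSum k (shiftBy 1 g) n
    atUnit k k<r = trans (∑-cong term Tₙ) (∑-*ˡ (g (suc k) 0) _ Tₙ)
      where
      term : ∀ S → (if shadowed 0 (zipWith _∷_ (unit r k) S) then weight g (zipWith _∷_ (unit r k) S) else 0#) ≈
                   g (suc k) 0 * (if shadowed k S then weight (shiftBy 1 g) S else 0#)
      term S = begin
        (if shadowed 0 (zipWith _∷_ (unit r k) S) then weight g (zipWith _∷_ (unit r k) S) else 0#)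
          ≡⟨ ≡.cong (λ b → if b then weight g (zipWith _∷_ (unit r k) S) else 0#)
                    (≡.trans (shadowed-zipWith-zero (unit r k) S) (unitAnd-unit k<r (λ k → shadowed k S))) ⟩
        (if shadowed k S then weight g (zipWith _∷_ (unit r k) S) else 0#)
          ≈⟨ if-cong (shadowed k S) (trans (weight-zipWith g (unit r k) S) (*-cong (∏-imap-unit (λ _ → refl) k<r) refl)) ⟩
        (if shadowed k S then g (suc k) 0 * weight (shiftBy 1 g) S else 0#)
          ≈⟨ *-if (shadowed k S) (g (suc k) 0) _ ⟨
        g (suc k) 0 * (if shadowed k S then weight (shiftBy 1 g) S else 0#) ∎

  shadowSum-shift : ∀ p g n → shadowSum p g n ≈ 𝓖 (shiftBy p g) ⦅ n ∸ p ⦆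
  shadowSum-shift zero    g n       = reflexive (≡.sym (⦅⦆-≤ (𝓖 g) z≤n))
  shadowSum-shift (suc p) g zero    =
    trans (shadowSum-zero (suc p) g) (reflexive (≡.sym (⦅⦆-> (𝓖 (shiftBy (suc p) g)) (s≤s z≤n))))
  shadowSum-shift (suc p) g (suc n) = begin
    shadowSum (suc p) g (suc n)                 ≈⟨ shadowSum-suc-suc p g n ⟩
    shadowSum p (shiftBy 1 g) n                 ≈⟨ shadowSum-shift p (shiftBy 1 g) n ⟩
    𝓖 (shiftBy (suc p) g) ⦅ n ∸ p ⦆             ≡⟨ ⦅⦆-suc (𝓖 (shiftBy (suc p) g)) n p ⟨
    𝓖 (shiftBy (suc p) g) ⦅ suc n ∸ suc p ⦆     ∎

  ∑-fromTo-1-zero : {f : ℕ → Carrier} → (∀ k → f (suc k) ≈ 0#) → ∑ (map f (fromTo 1 r)) ≈ 0#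
  ∑-fromTo-1-zero {f} f≈0 = trans (reflexive (∑-fromTo-1 f)) (∑-zero f≈0 (upTo r))

  𝓖-first-block : ∀ g n → 𝓖 g n ≈ δ n + ∑ (map (λ k → g k 0 * 𝓖 (shiftBy k g) ⦅ n ∸ k ⦆) (fromTo 1 r))
  𝓖-first-block g zero    =
    trans (shadowSum-zero 0 g) (sym (trans (+-cong refl (∑-fromTo-1-zero vanishes)) (+-identityʳ 1#)))
    where
    vanishes : ∀ k → g (suc k) 0 * 𝓖 (shiftBy (suc k) g) ⦅ 0 ∸ suc k ⦆ ≈ 0#
    vanishes k = trans (*-cong refl (reflexive (⦅⦆-> (𝓖 (shiftBy (suc k) g)) (s≤s z≤n)))) (zeroʳ _)
  𝓖-first-block g (suc n) = begin
    𝓖 g (suc n)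
      ≈⟨ 𝓖-suc g n ⟩
    ∑ (map (λ k → g (suc k) 0 * shadowSum k (shiftBy 1 g) n) (upTo r))
      ≈⟨ ∑-cong (λ k → *-cong refl (shadowSum-shift k (shiftBy 1 g) n)) (upTo r) ⟩
    ∑ (map (λ k → g (suc k) 0 * 𝓖 (shiftBy (suc k) g) ⦅ n ∸ k ⦆) (upTo r))
      ≡⟨ ≡.cong ∑ (Listₚ.map-cong (λ k → ≡.cong (g (suc k) 0 *_) (⦅⦆-suc (𝓖 (shiftBy (suc k) g)) n k))
                                  (upTo r)) ⟨
    ∑ (map (λ k → g (suc k) 0 * 𝓖 (shiftBy (suc k) g) ⦅ suc n ∸ suc k ⦆) (upTo r))
      ≡⟨ ∑-fromTo-1 (λ k → g k 0 * 𝓖 (shiftBy k g) ⦅ suc n ∸ k ⦆) ⟨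
    ∑ (map (λ k → g k 0 * 𝓖 (shiftBy k g) ⦅ suc n ∸ k ⦆) (fromTo 1 r))
      ≈⟨ +-identityˡ _ ⟨
    δ (suc n) + ∑ (map (λ k → g k 0 * 𝓖 (shiftBy k g) ⦅ suc n ∸ k ⦆) (fromTo 1 r)) ∎

  LastBlockRecursion : (ℕ → ℕ → Carrier) → ℕ → Set ℓ
  LastBlockRecursion g n = 𝓖 g n ≈ δ n + ∑ (map (λ k → (λ i → g k i * 𝓖 g i) ⦅ n ∸ k ⦆) (fromTo 1 r))

  -- Removing from the partitions counted by 𝓖 g n first a first block of length k and then a
  -- last block of length l, or the other way round.
  firstThenLast lastThenFirst : (ℕ → ℕ → Carrier) → ℕ → ℕ → ℕ → Carrier
  firstThenLast g n k l = (λ i → (λ j → g k 0 * (g l (k Nat.+ j) * 𝓖 (shiftBy k g) j)) ⦅ i ∸ l ⦆) ⦅ n ∸ k ⦆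
  lastThenFirst g n l k = (λ i → (λ j → g l i * (g k 0 * 𝓖 (shiftBy k g) j)) ⦅ i ∸ k ⦆) ⦅ n ∸ l ⦆

  firstThenLast≈lastThenFirst : ∀ g n k l → firstThenLast g n k l ≈ lastThenFirst g n l k
  firstThenLast≈lastThenFirst g n k l =
    trans (⦅⦆-swap (λ a j → g k 0 * (g l a * 𝓖 (shiftBy k g) j)) n k l)
          (⦅⦆-cong n l (⦅⦆-cong {λ j → g k 0 * (g l (n ∸ l) * 𝓖 (shiftBy k g) j)}
                                 {λ j → g l (n ∸ l) * (g k 0 * 𝓖 (shiftBy k g) j)}
                                 (n ∸ l) k (x∙yz≈y∙xz _ _ _)))

  first-block-expansion : ∀ g n k → LastBlockRecursion (shiftBy k g) (n ∸ k) →
    g k 0 * 𝓖 (shiftBy k g) ⦅ n ∸ k ⦆ ≈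
    (λ i → g k 0 * δ i) ⦅ n ∸ k ⦆ + ∑ (map (firstThenLast g n k) (fromTo 1 r))
  first-block-expansion g n k last = begin
    g k 0 * 𝓖 gₖ ⦅ n ∸ k ⦆
      ≈⟨ *-⦅⦆ (g k 0) (𝓖 gₖ) n k ⟩
    (λ i → g k 0 * 𝓖 gₖ i) ⦅ n ∸ k ⦆
      ≈⟨ ⦅⦆-cong n k (*-cong refl last) ⟩
    (λ i → g k 0 * (δ i + ∑ (map (λ l → (λ j → gₖ l j * 𝓖 gₖ j) ⦅ i ∸ l ⦆) (fromTo 1 r)))) ⦅ n ∸ k ⦆
      ≈⟨ ⦅⦆-distrib (λ _ → g k 0) δ (λ i l → (λ j → gₖ l j * 𝓖 gₖ j) ⦅ i ∸ l ⦆) (fromTo 1 r) n k ⟩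
    (λ i → g k 0 * δ i) ⦅ n ∸ k ⦆ + ∑ (map (λ l → (λ i → g k 0 * (λ j → gₖ l j * 𝓖 gₖ j) ⦅ i ∸ l ⦆) ⦅ n ∸ k ⦆) (fromTo 1 r))
      ≈⟨ +-cong refl (∑-cong (λ l → ⦅⦆-cong n k (*-⦅⦆ (g k 0) (λ j → gₖ l j * 𝓖 gₖ j) (n ∸ k) l)) (fromTo 1 r)) ⟩
    (λ i → g k 0 * δ i) ⦅ n ∸ k ⦆ + ∑ (map (firstThenLast g n k) (fromTo 1 r)) ∎
    where
    gₖ : ℕ → ℕ → Carrier
    gₖ = shiftBy k g

  last-block-expansion : ∀ g n l →
    (λ i → g l i * 𝓖 g i) ⦅ n ∸ l ⦆ ≈ (λ i → g l i * δ i) ⦅ n ∸ l ⦆ + ∑ (map (lastThenFirst g n l) (fromTo 1 r))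
  last-block-expansion g n l = begin
    (λ i → g l i * 𝓖 g i) ⦅ n ∸ l ⦆
      ≈⟨ ⦅⦆-cong n l (*-cong refl (𝓖-first-block g (n ∸ l))) ⟩
    (λ i → g l i * (δ i + ∑ (map (λ k → g k 0 * 𝓖 (shiftBy k g) ⦅ i ∸ k ⦆) (fromTo 1 r)))) ⦅ n ∸ l ⦆
      ≈⟨ ⦅⦆-distrib (g l) δ (λ i k → g k 0 * 𝓖 (shiftBy k g) ⦅ i ∸ k ⦆) (fromTo 1 r) n l ⟩
    (λ i → g l i * δ i) ⦅ n ∸ l ⦆ + ∑ (map (λ k → (λ i → g l i * (g k 0 * 𝓖 (shiftBy k g) ⦅ i ∸ k ⦆)) ⦅ n ∸ l ⦆) (fromTo 1 r))
      ≈⟨ +-cong refl (∑-cong (λ k → ⦅⦆-cong n l (trans (*-cong refl (*-⦅⦆ (g k 0) (𝓖 (shiftBy k g)) (n ∸ l) k))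
                                                         (*-⦅⦆ (g l (n ∸ l)) _ (n ∸ l) k))) (fromTo 1 r)) ⟩
    (λ i → g l i * δ i) ⦅ n ∸ l ⦆ + ∑ (map (lastThenFirst g n l) (fromTo 1 r)) ∎

  *-δ : (a : ℕ → Carrier) (i : ℕ) → a 0 * δ i ≈ a i * δ i
  *-δ a zero    = refl
  *-δ a (suc i) = trans (zeroʳ _) (sym (zeroʳ _))

  𝓖-last-block-suc : ∀ g n → (∀ k → LastBlockRecursion (shiftBy (suc k) g) (n ∸ k)) → LastBlockRecursion g (suc n)
  𝓖-last-block-suc g n last = begin
    𝓖 g N
      ≈⟨ 𝓖-first-block g N ⟩
    δ N + ∑ (map (λ k → g k 0 * 𝓖 (shiftBy k g) ⦅ N ∸ k ⦆) K)
      ≈⟨ +-cong refl (∑-cong-fromTo-1 (λ k → first-block-expansion g N (suc k) (last k))) ⟩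
    δ N + ∑ (map (λ k → X k + ∑ (map (firstThenLast g N k) K)) K)
      ≈⟨ +-cong refl (∑-+ X _ K) ⟩
    δ N + (∑ (map X K) + ∑ (map (λ k → ∑ (map (firstThenLast g N k) K)) K))
      ≈⟨ +-cong refl (+-cong (∑-cong (λ k → ⦅⦆-cong N k (*-δ (g k) (N ∸ k))) K)
                              (trans (∑-comm (firstThenLast g N) K K)
                                     (∑-cong (λ l → ∑-cong (λ k → firstThenLast≈lastThenFirst g N k l) K) K))) ⟩
    δ N + (∑ (map X′ K) + ∑ (map (λ l → ∑ (map (lastThenFirst g N l) K)) K))
      ≈⟨ +-cong refl (∑-+ X′ _ K) ⟨
    δ N + ∑ (map (λ l → X′ l + ∑ (map (lastThenFirst g N l) K)) K)
      ≈⟨ +-cong refl (∑-cong (last-block-expansion g N) K) ⟨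
    δ N + ∑ (map (λ l → (λ i → g l i * 𝓖 g i) ⦅ N ∸ l ⦆) K) ∎
    where
    N : ℕ
    N = suc n
    K : List ℕ
    K = fromTo 1 r
    X X′ : ℕ → Carrier
    X  k = (λ i → g k 0 * δ i) ⦅ N ∸ k ⦆
    X′ l = (λ i → g l i * δ i) ⦅ N ∸ l ⦆

  𝓖-last-block : ∀ n g → LastBlockRecursion g n
  𝓖-last-block = <-rec _ λ where
    zero    _    g → trans (shadowSum-zero 0 g) (sym (trans (+-cong refl (∑-fromTo-1-zero
                       (λ k → reflexive (⦅⦆-> (λ i → g (suc k) i * 𝓖 g i) (s≤s z≤n))))) (+-identityʳ 1#)))
    (suc n) last g → 𝓖-last-block-suc g n (λ k → last (s≤s (ℕₚ.m∸n≤m n k)) (shiftBy (suc k) g))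

module Evaluation {c ℓ} (K : Field c ℓ) (q : ℕ) {{_ : Nat.NonZero q}} (θ : Field.Carrier K) (r : ℕ)
  (A : ℕ → Field.Carrier K) (t : Field.Carrier K) (t≉θ^q^ : ∀ s → ¬ (Field._≈_ K t (pow K θ (q ^ s)))) where
  open Field K hiding (_-_)
  open WeightedCount commutativeSemiring r
  open FoldProperties +-commutativeMonoid using () renaming (fold to ∑)
  open FoldProperties *-commutativeMonoid using () renaming (fold to ∏)
  open import Algebra.Properties.Semiring.Exp semiring using (^-assocʳ) renaming (_^_ to _^ᴷ_)
  open import Algebra.Properties.Group +-group using (x∙y⁻¹≈ε⇒x≈y)
  open import Relation.Binary.Reasoning.Setoid setoid

  pow-pow : ∀ x a b → pow K (pow K x a) b ≈ pow K x (a Nat.* b)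
  pow-pow x a b = begin
    pow K (pow K x a) b ≡⟨ ≡.trans (pow≡^ (pow K x a) b) (≡.cong (_^ᴷ b) (pow≡^ x a)) ⟩
    (x ^ᴷ a) ^ᴷ b       ≈⟨ ^-assocʳ x a b ⟩
    x ^ᴷ (a Nat.* b)    ≡⟨ pow≡^ x (a Nat.* b) ⟨
    pow K x (a Nat.* b) ∎
    where
    pow≡^ : ∀ x n → pow K x n ≡ x ^ᴷ n
    pow≡^ x zero    = ≡.refl
    pow≡^ x (suc n) = ≡.cong (x *_) (pow≡^ x n)

  pow-1# : ∀ n → pow K 1# n ≈ 1#
  pow-1# zero    = refl
  pow-1# (suc n) = trans (*-identityˡ _) (pow-1# n)

  pow-0#-q^ : ∀ k → pow K 0# (q ^ k) ≈ 0#
  pow-0#-q^ k with q ^ k | ℕₚ.m^n>0 q k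
  ... | suc _ | _ = zeroˡ _

  -- _⁻¹ is constrained only away from 0, so it respects ≈ only there: this is where
  -- t ≉ θ^{q^s} is needed.
  ⁻¹-cong : ∀ {x y} → x ≈ y → ¬ (y ≈ 0#) → x ⁻¹ ≈ y ⁻¹
  ⁻¹-cong {x} {y} x≈y y≉0 = begin
    x ⁻¹               ≈⟨ *-identityʳ _ ⟨
    x ⁻¹ * 1#          ≈⟨ *-cong refl (⁻¹-inverse y y≉0) ⟨
    x ⁻¹ * (y * y ⁻¹)  ≈⟨ *-assoc _ _ _ ⟨
    (x ⁻¹ * y) * y ⁻¹  ≈⟨ *-cong (*-cong refl x≈y) refl ⟨
    (x ⁻¹ * x) * y ⁻¹  ≈⟨ *-cong (*-comm _ _) refl ⟩
    (x * x ⁻¹) * y ⁻¹  ≈⟨ *-cong (⁻¹-inverse x (λ x≈0 → y≉0 (trans (sym x≈y) x≈0))) refl ⟩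
    1# * y ⁻¹          ≈⟨ *-identityˡ _ ⟩
    y ⁻¹               ∎

  factor : ℕ → ℕ → Carrier
  factor i j = pow K (A i) (q ^ j) * (t + - pow K θ (q ^ (i Nat.+ j))) ⁻¹

  twisted-factor : ∀ k i j →
    pow K (pow K (A i) (q ^ j)) (q ^ k) * (t + - pow K (pow K θ (q ^ (i Nat.+ j))) (q ^ k)) ⁻¹ ≈ shiftBy k factor i j
  twisted-factor k i j = *-cong
    (trans (pow-pow (A i) (q ^ j) (q ^ k)) (reflexive (≡.cong (pow K (A i)) q^j*q^k≡q^[k+j])))
    (⁻¹-cong (+-cong refl (-‿cong (trans (pow-pow θ (q ^ (i Nat.+ j)) (q ^ k))
                                         (reflexive (≡.cong (pow K θ) q^[i+j]*q^k≡q^[i+[k+j]])))))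
             (λ t-θ≈0 → t≉θ^q^ (i Nat.+ (k Nat.+ j)) (x∙y⁻¹≈ε⇒x≈y t _ t-θ≈0)))
    where
    q^j*q^k≡q^[k+j] : q ^ j Nat.* q ^ k ≡ q ^ (k Nat.+ j)
    q^j*q^k≡q^[k+j] = ≡.trans (ℕₚ.*-comm (q ^ j) (q ^ k)) (≡.sym (ℕₚ.^-distribˡ-+-* q k j))
    q^[i+j]*q^k≡q^[i+[k+j]] : q ^ (i Nat.+ j) Nat.* q ^ k ≡ q ^ (i Nat.+ (k Nat.+ j))
    q^[i+j]*q^k≡q^[i+[k+j]] = ≡.trans (≡.sym (ℕₚ.^-distribˡ-+-* q (i Nat.+ j) k))
      (≡.cong (q ^_) (≡.trans (ℕₚ.+-assoc i j k) (≡.cong (i Nat.+_) (ℕₚ.+-comm j k))))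

  eval-Σᵉ : (f : B → RatExpr Carrier) (w : B → Carrier) → (∀ x → eval K t (f x) ≈ w x) →
    ∀ xs → eval K t (Σᵉ K (map f xs)) ≈ ∑ (map w xs)
  eval-Σᵉ f w f≈w []       = refl
  eval-Σᵉ f w f≈w (x ∷ xs) = +-cong (f≈w x) (eval-Σᵉ f w f≈w xs)

  eval-Πᵉ : (f : B → RatExpr Carrier) (w : B → Carrier) → (∀ x → eval K t (f x) ≈ w x) →
    ∀ xs → eval K t (Πᵉ K (map f xs)) ≈ ∏ (map w xs)
  eval-Πᵉ f w f≈w []       = refl
  eval-Πᵉ f w f≈w (x ∷ xs) = *-cong (f≈w x) (eval-Πᵉ f w f≈w xs)

  eval-twist-Σᵉ : ∀ k (f : B → RatExpr Carrier) (w : B → Carrier) → (∀ x → eval K t (twist K q k (f x)) ≈ w x) →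
    ∀ xs → eval K t (twist K q k (Σᵉ K (map f xs))) ≈ ∑ (map w xs)
  eval-twist-Σᵉ k f w f≈w []       = pow-0#-q^ k
  eval-twist-Σᵉ k f w f≈w (x ∷ xs) = +-cong (f≈w x) (eval-twist-Σᵉ k f w f≈w xs)

  eval-twist-Πᵉ : ∀ k (f : B → RatExpr Carrier) (w : B → Carrier) → (∀ x → eval K t (twist K q k (f x)) ≈ w x) →
    ∀ xs → eval K t (twist K q k (Πᵉ K (map f xs))) ≈ ∏ (map w xs)
  eval-twist-Πᵉ k f w f≈w []       = pow-1# (q ^ k)
  eval-twist-Πᵉ k f w f≈w (x ∷ xs) = *-cong (f≈w x) (eval-twist-Πᵉ k f w f≈w xs)

  eval-𝓑ℕ : ∀ n → eval K t (𝓑ℕ K q θ r A n) ≈ 𝓖 factor n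
  eval-𝓑ℕ n = trans
    (eval-Σᵉ _ (weight factor)
       (λ S → eval-Πᵉ _ _ (λ i → eval-Πᵉ _ (factor (suc (toℕ i))) (λ _ → refl) (filterᵇ (mem (lookup S i)) (upTo n)))
                      (allFin r))
       (P r n))
    (∑-weight-P factor n)

  eval-twist-𝓑ℕ : ∀ k n → eval K t (twist K q k (𝓑ℕ K q θ r A n)) ≈ 𝓖 (shiftBy k factor) n
  eval-twist-𝓑ℕ k n = trans
    (eval-twist-Σᵉ k _ (weight (shiftBy k factor))
       (λ S → trans (eval-twist-Πᵉ k _ _ (λ i → eval-twist-Πᵉ k _ (g (suc (toℕ i))) (λ _ → refl)
                                                                (filterᵇ (mem (lookup S i)) (upTo n)))
                                         (allFin r))
                    (weight-cong (twisted-factor k) S))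
       (P r n))
    (∑-weight-P (shiftBy k factor) n)
    where
    g : ℕ → ℕ → Carrier
    g i j = pow K (pow K (A i) (q ^ j)) (q ^ k) * (t + - pow K (pow K θ (q ^ (i Nat.+ j))) (q ^ k)) ⁻¹

  eval-𝓑-difference : (ev : RatExpr Carrier → Carrier) (f : ℕ → Carrier) → ev (const 0#) ≈ 0# →
    (∀ n → ev (𝓑ℕ K q θ r A n) ≈ f n) → ∀ m k → ev (𝓑 K q θ r A (+ m - + k)) ≈ f ⦅ m ∸ k ⦆
  eval-𝓑-difference ev f ev0≈0 ev𝓑≈f m k with k ℕₚ.≤? m
  ... | yes k≤m = begin
    ev (𝓑 K q θ r A (+ m - + k))
      ≡⟨ ≡.cong (ev ∘ 𝓑 K q θ r A) (≡.trans (ℤₚ.[+m]-[+n]≡m⊖n m k) (ℤₚ.⊖-≥ k≤m)) ⟩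
    ev (𝓑ℕ K q θ r A (m ∸ k))      ≈⟨ ev𝓑≈f (m ∸ k) ⟩
    f (m ∸ k)                      ≡⟨ ⦅⦆-≤ f k≤m ⟨
    f ⦅ m ∸ k ⦆                    ∎
  ... | no k≰m = begin
    ev (𝓑 K q θ r A (+ m - + k))
      ≡⟨ ≡.cong (ev ∘ 𝓑 K q θ r A) (≡.trans (ℤₚ.[+m]-[+n]≡m⊖n m k) (ℤₚ.⊖-≰ k≰m)) ⟩
    ev (𝓑 K q θ r A (ℤ.- + (k ∸ m))) ≈⟨ negative (ℕₚ.m<n⇒0<n∸m (ℕₚ.≰⇒> k≰m)) ⟩
    0#                             ≡⟨ ⦅⦆-> f (ℕₚ.≰⇒> k≰m) ⟨
    f ⦅ m ∸ k ⦆                    ∎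
    where
    negative : ∀ {x} → 0 < x → ev (𝓑 K q θ r A (ℤ.- + x)) ≈ 0#
    negative {suc x} _ = ev0≈0

  eval-first-term : ∀ m k →
    eval K t (const (A k) ⊗ inv (var ⊕ neg (const (pow K θ (q ^ k)))) ⊗ twist K q k (𝓑 K q θ r A (+ m - + k)))
      ≈ factor k 0 * 𝓖 (shiftBy k factor) ⦅ m ∸ k ⦆
  eval-first-term m k = *-cong
    (*-cong (sym (*-identityʳ (A k)))
            (reflexive (≡.cong (λ s → (t + - pow K θ (q ^ s)) ⁻¹) (≡.sym (ℕₚ.+-identityʳ k)))))
    (eval-𝓑-difference (eval K t ∘ twist K q k) (𝓖 (shiftBy k factor)) (pow-0#-q^ k) (eval-twist-𝓑ℕ k) m k)

  eval-last-term : ∀ m k →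
    eval K t (const (pow K (A k) (q ^ (m ∸ k))) ⊗ inv (var ⊕ neg (const (pow K θ (q ^ m)))) ⊗ 𝓑 K q θ r A (+ m - + k))
      ≈ (λ i → factor k i * 𝓖 factor i) ⦅ m ∸ k ⦆
  eval-last-term m k with k ℕₚ.≤? m
  ... | yes k≤m = begin
    coefficient * eval K t (𝓑 K q θ r A (+ m - + k))
      ≈⟨ *-cong coefficient≈factor (eval-𝓑-difference (eval K t) (𝓖 factor) refl eval-𝓑ℕ m k) ⟩
    factor k (m ∸ k) * 𝓖 factor ⦅ m ∸ k ⦆     ≡⟨ ≡.cong (factor k (m ∸ k) *_) (⦅⦆-≤ (𝓖 factor) k≤m) ⟩
    factor k (m ∸ k) * 𝓖 factor (m ∸ k)        ≡⟨ ⦅⦆-≤ (λ i → factor k i * 𝓖 factor i) k≤m ⟨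
    (λ i → factor k i * 𝓖 factor i) ⦅ m ∸ k ⦆ ∎
    where
    coefficient : Carrier
    coefficient = pow K (A k) (q ^ (m ∸ k)) * (t + - pow K θ (q ^ m)) ⁻¹
    coefficient≈factor : coefficient ≈ factor k (m ∸ k)
    coefficient≈factor = reflexive (≡.cong (λ s → pow K (A k) (q ^ (m ∸ k)) * (t + - pow K θ (q ^ s)) ⁻¹)
                                           (≡.sym (ℕₚ.m+[n∸m]≡n k≤m)))
  ... | no k≰m = begin
    _ * eval K t (𝓑 K q θ r A (+ m - + k))
      ≈⟨ *-cong refl (eval-𝓑-difference (eval K t) (𝓖 factor) refl eval-𝓑ℕ m k) ⟩
    _ * 𝓖 factor ⦅ m ∸ k ⦆                    ≡⟨ ≡.cong (_ *_) (⦅⦆-> (𝓖 factor) (ℕₚ.≰⇒> k≰m)) ⟩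
    _ * 0#                                     ≈⟨ zeroʳ _ ⟩
    0#                                         ≡⟨ ⦅⦆-> (λ i → factor k i * 𝓖 factor i) (ℕₚ.≰⇒> k≰m) ⟨
    (λ i → factor k i * 𝓖 factor i) ⦅ m ∸ k ⦆ ∎

lemma6p7 : ∀ {c ℓ : Level} (K : Field c ℓ) (p e : ℕ) → Prime p → 1 ≤ e → HasChar K p →
    (θ : Field.Carrier K) (r : ℕ) → 1 ≤ r → (A : ℕ → Field.Carrier K) →
    ¬ (Field._≈_ K (A r) (Field.0# K)) →
    (m : ℕ) → 1 ≤ m →
    (t : Field.Carrier K) → (∀ s → ¬ (Field._≈_ K t (pow K θ ((p ^ e) ^ s)))) →
    Field._≈_ K (eval K t (𝓑 K (p ^ e) θ r A (+ m)))
      (eval K t (Σᵉ K (map (λ k → const (A k) ⊗ inv (var ⊕ neg (const (pow K θ ((p ^ e) ^ k))))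
                                ⊗ twist K (p ^ e) k (𝓑 K (p ^ e) θ r A (+ m - + k)))
                          (fromTo 1 r))))
    ×
    Field._≈_ K (eval K t (𝓑 K (p ^ e) θ r A (+ m)))
      (eval K t (Σᵉ K (map (λ k → const (pow K (A k) ((p ^ e) ^ (m Data.Nat.∸ k))) ⊗ inv (var ⊕ neg (const (pow K θ ((p ^ e) ^ m))))
                                ⊗ 𝓑 K (p ^ e) θ r A (+ m - + k))
                          (fromTo 1 r))))
lemma6p7 K p e p-prime _ _ θ r _ A _ (suc m) _ t t≉θ^q^ =
  trans (eval-𝓑ℕ (suc m)) (trans (𝓖-first-block factor (suc m)) (trans (+-identityˡ _)
    (sym (eval-Σᵉ _ _ (eval-first-term (suc m)) (fromTo 1 r))))) ,
  trans (eval-𝓑ℕ (suc m)) (trans (𝓖-last-block (suc m) factor) (trans (+-identityˡ _)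
    (sym (eval-Σᵉ _ _ (eval-last-term (suc m)) (fromTo 1 r)))))
  where
  instance
    p≢0 : Nat.NonZero p
    p≢0 = prime⇒nonZero p-prime
    q≢0 : Nat.NonZero (p ^ e)
    q≢0 = ℕₚ.m^n≢0 p e
  open Field K hiding (_-_)
  open Evaluation K (p ^ e) θ r A t t≉θ^q^
  open WeightedCount commutativeSemiring r
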